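{- Let $G$ be a finite simple graph of order $n$ and $\overline{G}$ its complement. If $G$ is not isomorphic to $C_5$ and $\gamma_{\rm ri2}(G)=4$, then $\gamma_{\rm ri2}(\overline{G})\leq n-2$.
   Context: A 2RiDF of a graph $G$ is a function $f: V(G)\to\{0,1,2\}$ such that for each $i\in\{1,2\}$ the set $\{v:f(v)=i\}$ is independent and every vertex $v$ with $f(v)=0$ has a neighbor $u$ with $f(u)=i$; its weight is the number of vertices with nonzero value, and $\gamma_{\rm ri2}(G)$ is the minimum weight of a 2RiDF of $G$. $C_5$ is the cycle of length 5. -}

module Defs where

open import Data.Nat using (ℕ; suc; _≤_; _+_)
open import Data.Fin using (Fin; toℕ)
open import Data.Fin.Properties using ()
open import Data.Bool using (Bool; true; false; not)
open import Data.Product using (Σ; ∃; ∃-syntax; _×_; _,_)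
open import Data.List using (List; length; filter)
open import Data.List using () renaming (allFin to allFinL)
open import Relation.Binary.PropositionalEquality using (_≡_; _≢_)
open import Relation.Nullary using (¬_)
open import Function.Bundles using (_↔_; Inverse)
import Data.Nat as ℕ

record Graph (n : ℕ) : Set where
  field
    adj   : Fin n → Fin n → Bool
    adj-sym   : ∀ u v → adj u v ≡ adj v u
    adj-irref : ∀ v → adj v v ≡ false

open Graph public

Adj : ∀ {n} → Graph n → Fin n → Fin n → Set
Adj G u v = adj G u v ≡ true

complement : ∀ {n} → Graph n → Graph n
complement {n} G = record
  { adj   = λ u v → cadj u v
  ; adj-sym   = λ u v → csym u v
  ; adj-irref = λ v → cirr v
  }
  where
    open import Data.Fin using (_≟_)
    open import Relation.Nullary using (yes; no)
    open import Relation.Binary.PropositionalEquality using (refl; cong; sym)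
    cadj : Fin n → Fin n → Bool
    cadj u v with u ≟ v
    ... | yes _ = false
    ... | no  _ = not (adj G u v)
    csym : ∀ u v → cadj u v ≡ cadj v u
    csym u v with u ≟ v | v ≟ u
    ... | yes _ | yes _ = refl
    ... | yes p | no q = Data.Empty.⊥-elim (q (sym p)) where import Data.Empty
    ... | no p | yes q = Data.Empty.⊥-elim (p (sym q)) where import Data.Empty
    ... | no _ | no _ = cong not (adj-sym G u v)
    cirr : ∀ v → cadj v v ≡ false
    cirr v with v ≟ v
    ... | yes _ = refl
    ... | no p = Data.Empty.⊥-elim (p refl) where import Data.Empty

C5adj : Fin 5 → Fin 5 → Bool
C5adj u v = step (toℕ u) (toℕ v)
  where
    step : ℕ → ℕ → Bool
    step 0 1 = true
    step 1 2 = true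
    step 2 3 = true
    step 3 4 = true
    step 4 0 = true
    step 1 0 = true
    step 2 1 = true
    step 3 2 = true
    step 4 3 = true
    step 0 4 = true
    step _ _ = false

IsoToC5 : ∀ {n} → Graph n → Set
IsoToC5 {n} G = Σ (Fin n ↔ Fin 5) λ φ →
  ∀ u v → adj G u v ≡ C5adj (Inverse.to φ u) (Inverse.to φ v)

Is2RiDF : ∀ {n} → Graph n → (Fin n → Fin 3) → Set
Is2RiDF {n} G f =
  (∀ (i : Fin 3) → toℕ i ≢ 0 → ∀ u v → f u ≡ i → f v ≡ i → ¬ Adj G u v)
  × (∀ v → toℕ (f v) ≡ 0 → ∀ (i : Fin 3) → toℕ i ≢ 0 → ∃[ u ] (Adj G v u × f u ≡ i))

weight : ∀ {n} → (Fin n → Fin 3) → ℕ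
weight {n} f = length (filter (λ v → ¬? (toℕ (f v) ℕ.≟ 0)) (allFinL n))
  where open import Relation.Nullary using (¬?)

IsGammaRi2 : ∀ {n} → Graph n → ℕ → Set
IsGammaRi2 {n} G k =
  (∃[ f ] (Is2RiDF G f × weight f ≡ k))
  × (∀ f → Is2RiDF G f → k ≤ weight f)

-- Write H for the complement of G. A 2RiDF of H with two vertices of weight 0 comes from a
-- "doubly dominated pair": distinct x, y each having a neighbour in P and one in Q, for disjoint
-- independent sets P, Q of H. Extend P and then Q greedily to maximal independent sets avoiding
-- x and y and colour them 1 and 2.
-- Since γ_ri2(G) = 4, no assignment p, a ↦ 1, q ↦ 2 is a 2RiDF of G. In H this says: if all
-- neighbours of q lie in {p, a}, where p = a or pa is an edge, then p and a have another common
-- neighbour. This forces minimum degree 2, and lets every triangle, every path on five vertices and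
-- every 5-cycle of H be completed to a doubly dominated pair, unless H is an induced spanning
-- 5-cycle, in which case G ≅ C₅.
module Submission where

open import Defs
open import Data.Nat using (ℕ; _≤_; _∸_)
open import Relation.Nullary using (¬_)

open import Data.Bool using (true; false; not)
open import Data.Bool.Properties using (not-injective)
import Data.Bool as Bool
open import Data.Fin using (Fin; toℕ; _≟_)
open import Data.Fin.Patterns using (0F; 1F; 2F; 3F; 4F)
open import Data.Fin.Properties using (any?; all?)
open import Data.Fin.Subset using (Subset; ⁅_⁆; _∪_; _∈_; _∉_; _⊆_)
open import Data.Fin.Subset.Properties using (_∈?_; x∈⁅x⁆; x∈⁅y⁆⇒x≡y; x∈p∪q⁺; x∈p∪q⁻)
open import Data.List using (List; []; _∷_; length; filter; allFin)
open import Data.List.Membership.Propositional using () renaming (_∈_ to _∈ₗ_)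
open import Data.List.Membership.Propositional.Properties using (∈-filter⁺; ∈-filter⁻; ∈-allFin)
open import Data.List.Properties using (filter-notAll; length-tabulate)
open import Data.List.Relation.Unary.All using (All; _∷_)
open import Data.List.Relation.Unary.AllPairs using (_∷_)
import Data.List.Relation.Unary.Any as Any
open import Data.List.Relation.Unary.Any using (here; there)
open import Data.List.Relation.Unary.Unique.Propositional using (Unique)
open import Data.List.Relation.Unary.Unique.Propositional.Properties using (filter⁺; allFin⁺)
open import Data.Nat using (suc; z≤n; s≤s) renaming (_≟_ to _≟ℕ_)
open import Data.Nat.Properties using (≤-trans; ≤-reflexive; ∸-monoˡ-≤; <⇒≱)
open import Data.Product using (∃-syntax; _×_; _,_; proj₁; proj₂)
open import Data.Sum using (_⊎_; inj₁; inj₂; [_,_]′)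
open import Function using (_∘_; id)
open import Function.Bundles using (mk↔ₛ′)
open import Level using (0ℓ)
open import Relation.Binary.Definitions using (DecidableEquality)
open import Relation.Binary.PropositionalEquality
  using (_≡_; _≢_; refl; sym; trans; cong; cong₂; subst; module ≡-Reasoning)
open import Relation.Nullary using (Dec; yes; no; ¬?; contradiction)
open import Relation.Nullary.Decidable using (_×-dec_; _⊎-dec_; _→-dec_; decidable-stable; toWitness)
open import Relation.Unary using (Pred; Decidable)

module _ {A : Set} (_≟ᴬ_ : DecidableEquality A) where

  remove : A → List A → List A
  remove x = filter (λ y → ¬? (x ≟ᴬ y))

  length-remove< : ∀ {x ys} → x ∈ₗ ys → suc (length (remove x ys)) ≤ length ys
  length-remove< {ys = ys} x∈ys =
    filter-notAll (λ y → ¬? (_ ≟ᴬ y)) ys (Any.map (λ x≡y x≢y → x≢y x≡y) x∈ys)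

  ∈-remove : ∀ {x z ys} → z ∈ₗ ys → x ≢ z → z ∈ₗ remove x ys
  ∈-remove = ∈-filter⁺ (λ y → ¬? (_ ≟ᴬ y))

  length-≤-unique : ∀ {xs ys} → Unique xs → (∀ {z} → z ∈ₗ xs → z ∈ₗ ys) → length xs ≤ length ys
  length-≤-unique {[]} _ _ = z≤n
  length-≤-unique {x ∷ xs} {ys} (x∉xs ∷ xs-unique) xs⊆ys =
    ≤-trans (s≤s (length-≤-unique xs-unique (λ z∈xs → ∈-remove (xs⊆ys (there z∈xs)) (distinct x∉xs z∈xs))))
            (length-remove< (xs⊆ys (here refl)))
    where
      distinct : ∀ {zs z} → All (x ≢_) zs → z ∈ₗ zs → x ≢ z
      distinct (x≢z ∷ _) (here refl) = x≢z
      distinct (_ ∷ x≢zs) (there z∈zs) = distinct x≢zs z∈zs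

module _ {n : ℕ} (f : Fin n → Fin 3) where

  weight≤length : ∀ {xs} → (∀ {v} → toℕ (f v) ≢ 0 → v ∈ₗ xs) → weight f ≤ length xs
  weight≤length supported =
    length-≤-unique _≟_ (filter⁺ nonzero? (allFin⁺ n)) (supported ∘ proj₂ ∘ ∈-filter⁻ nonzero? {xs = allFin n})
    where
      nonzero? = λ v → ¬? (toℕ (f v) ≟ℕ 0)

  weight≤n∸2 : ∀ {x y} → x ≢ y → toℕ (f x) ≡ 0 → toℕ (f y) ≡ 0 → weight f ≤ n ∸ 2
  weight≤n∸2 {x} {y} x≢y fx≡0 fy≡0 = ≤-trans (weight≤length avoids) (∸-monoˡ-≤ 2 two-removed)
    where
      avoids : ∀ {v} → toℕ (f v) ≢ 0 → v ∈ₗ remove _≟_ y (remove _≟_ x (allFin n))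
      avoids {v} fv≢0 = ∈-remove _≟_ (∈-remove _≟_ (∈-allFin v) (λ { refl → fv≢0 fx≡0 })) λ { refl → fv≢0 fy≡0 }
      two-removed : suc (suc (length (remove _≟_ y (remove _≟_ x (allFin n))))) ≤ n
      two-removed = ≤-trans (s≤s (length-remove< _≟_ (∈-remove _≟_ (∈-allFin y) x≢y)))
                    (≤-trans (length-remove< _≟_ (∈-allFin x)) (≤-reflexive (length-tabulate id)))

  weight≤n : weight f ≤ n
  weight≤n = ≤-trans (weight≤length (λ {v} _ → ∈-allFin v)) (≤-reflexive (length-tabulate id))

module _ {n : ℕ} where

  ≢-sym : ∀ {u v : Fin n} → u ≢ v → v ≢ u
  ≢-sym u≢v = u≢v ∘ sym

  pair : Fin n → Fin n → Subset n
  pair p q = ⁅ p ⁆ ∪ ⁅ q ⁆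

  ∈-pair⁻ : ∀ {v p q} → v ∈ pair p q → v ≡ p ⊎ v ≡ q
  ∈-pair⁻ {p = p} {q} v∈ with x∈p∪q⁻ ⁅ p ⁆ ⁅ q ⁆ v∈
  ... | inj₁ v∈p = inj₁ (x∈⁅y⁆⇒x≡y p v∈p)
  ... | inj₂ v∈q = inj₂ (x∈⁅y⁆⇒x≡y q v∈q)

  ∈-pair⁺ : ∀ {v p q} → v ≡ p ⊎ v ≡ q → v ∈ pair p q
  ∈-pair⁺ (inj₁ refl) = x∈p∪q⁺ (inj₁ (x∈⁅x⁆ _))
  ∈-pair⁺ (inj₂ refl) = x∈p∪q⁺ (inj₂ (x∈⁅x⁆ _))

module _ {n : ℕ} (K : Graph n) where

  Independent : Subset n → Set
  Independent S = ∀ {u v} → u ∈ S → v ∈ S → ¬ Adj K u v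

  HasNeighbourIn : Subset n → Fin n → Set
  HasNeighbourIn S v = ∃[ u ] (u ∈ S × Adj K v u)

  hasNeighbourIn? : ∀ S v → Dec (HasNeighbourIn S v)
  hasNeighbourIn? S v = any? λ u → u ∈? S ×-dec (adj K v u Bool.≟ true)

  Adj-irrefl : ∀ v → ¬ Adj K v v
  Adj-irrefl v v~v with () ← trans (sym v~v) (adj-irref K v)

  Adj-sym : ∀ {u v} → Adj K u v → Adj K v u
  Adj-sym {u} {v} = trans (adj-sym K v u)

  singleton-independent : ∀ v → Independent ⁅ v ⁆
  singleton-independent v a∈ b∈ rewrite x∈⁅y⁆⇒x≡y v a∈ | x∈⁅y⁆⇒x≡y v b∈ = Adj-irrefl v

  hasNeighbourIn-mono : ∀ {S T v} → S ⊆ T → HasNeighbourIn S v → HasNeighbourIn T v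
  hasNeighbourIn-mono S⊆T (u , u∈S , v~u) = u , S⊆T u∈S , v~u

  hasNeighbourIn⇒∉ : ∀ {S v} → Independent S → HasNeighbourIn S v → v ∉ S
  hasNeighbourIn⇒∉ S-independent (u , u∈S , v~u) v∈S = S-independent v∈S u∈S v~u

  -- Maximality is only demanded along vs so that the extension can be built by recursion on vs.
  record IndependentExtension (C : Pred (Fin n) 0ℓ) (S : Subset n) (vs : List (Fin n)) : Set where
    field
      J           : Subset n
      independent : Independent J
      extends     : S ⊆ J
      within      : ∀ {v} → v ∈ J → C v
      maximal     : ∀ {v} → v ∈ₗ vs → C v → v ∉ J → HasNeighbourIn J v

  prepend : ∀ {C S S′ v vs} (E : IndependentExtension C S′ vs) → S ⊆ S′ →
            let open IndependentExtension E in (C v → v ∉ J → HasNeighbourIn J v) →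
            IndependentExtension C S (v ∷ vs)
  prepend E S⊆S′ maximal-at-v = record
    { J = J ; independent = independent ; extends = extends ∘ S⊆S′ ; within = within
    ; maximal = λ { (here refl) → maximal-at-v ; (there v∈vs) → maximal v∈vs } }
    where open IndependentExtension E

  module _ {C : Pred (Fin n) 0ℓ} (C? : Decidable C) where

    extendIndependent : ∀ {S} vs → Independent S → (∀ {v} → v ∈ S → C v) → IndependentExtension C S vs
    extendIndependent {S} [] S-independent S⊆C =
      record { J = S ; independent = S-independent ; extends = id ; within = S⊆C ; maximal = λ () }
    extendIndependent {S} (v ∷ vs) S-independent S⊆C with C? v | hasNeighbourIn? S v
    ... | no v∉C | _ = prepend (extendIndependent vs S-independent S⊆C) id λ v∈C _ → contradiction v∈C v∉C
    ... | yes _ | yes (u , u∈S , v~u) = prepend E id λ _ _ → u , extends u∈S , v~u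
      where E = extendIndependent vs S-independent S⊆C
            open IndependentExtension E
    ... | yes v∈C | no no-neighbour =
      prepend E (x∈p∪q⁺ ∘ inj₂) λ _ v∉J → contradiction (extends E (x∈p∪q⁺ (inj₁ (x∈⁅x⁆ v)))) v∉J
      where
        open IndependentExtension
        independent-with-v : Independent (⁅ v ⁆ ∪ S)
        independent-with-v {a} {b} a∈ b∈ with x∈p∪q⁻ ⁅ v ⁆ S a∈ | x∈p∪q⁻ ⁅ v ⁆ S b∈
        ... | inj₁ a∈v | inj₁ b∈v rewrite x∈⁅y⁆⇒x≡y v a∈v | x∈⁅y⁆⇒x≡y v b∈v = Adj-irrefl v
        ... | inj₁ a∈v | inj₂ b∈S rewrite x∈⁅y⁆⇒x≡y v a∈v = λ v~b → no-neighbour (b , b∈S , v~b)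
        ... | inj₂ a∈S | inj₁ b∈v rewrite x∈⁅y⁆⇒x≡y v b∈v = λ a~v → no-neighbour (a , a∈S , Adj-sym a~v)
        ... | inj₂ a∈S | inj₂ b∈S = S-independent a∈S b∈S
        within-with-v : ∀ {a} → a ∈ ⁅ v ⁆ ∪ S → C a
        within-with-v {a} a∈ with x∈p∪q⁻ ⁅ v ⁆ S a∈
        ... | inj₁ a∈v rewrite x∈⁅y⁆⇒x≡y v a∈v = v∈C
        ... | inj₂ a∈S = S⊆C a∈S
        E = extendIndependent vs independent-with-v within-with-v

  colouring : Subset n → Subset n → Fin n → Fin 3
  colouring A B v with v ∈? A | v ∈? B
  ... | yes _ | _     = 1F
  ... | no _  | yes _ = 2F
  ... | no _  | no _  = 0F

  module _ {A B : Subset n} where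

    colouring-∈₁ : ∀ {v} → v ∈ A → colouring A B v ≡ 1F
    colouring-∈₁ {v} v∈A with v ∈? A
    ... | yes _ = refl
    ... | no v∉A = contradiction v∈A v∉A

    colouring-∈₂ : ∀ {v} → v ∉ A → v ∈ B → colouring A B v ≡ 2F
    colouring-∈₂ {v} v∉A v∈B with v ∈? A | v ∈? B
    ... | yes v∈A | _ = contradiction v∈A v∉A
    ... | no _ | yes _ = refl
    ... | no _ | no v∉B = contradiction v∈B v∉B

    colouring-∉ : ∀ {v} → v ∉ A → v ∉ B → toℕ (colouring A B v) ≡ 0
    colouring-∉ {v} v∉A v∉B with v ∈? A | v ∈? B
    ... | yes v∈A | _ = contradiction v∈A v∉A
    ... | no _ | yes v∈B = contradiction v∈B v∉B
    ... | no _ | no _ = refl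

    colouring≡1⇒∈ : ∀ {v} → colouring A B v ≡ 1F → v ∈ A
    colouring≡1⇒∈ {v} eq with v ∈? A | v ∈? B
    colouring≡1⇒∈ refl | yes v∈A | _ = v∈A
    colouring≡1⇒∈ () | no _ | yes _
    colouring≡1⇒∈ () | no _ | no _

    colouring≡2⇒∈ : ∀ {v} → colouring A B v ≡ 2F → v ∈ B
    colouring≡2⇒∈ {v} eq with v ∈? A | v ∈? B
    colouring≡2⇒∈ () | yes _ | _
    colouring≡2⇒∈ refl | no _ | yes v∈B = v∈B
    colouring≡2⇒∈ () | no _ | no _

    colouring≡0⇒∉ : ∀ {v} → toℕ (colouring A B v) ≡ 0 → v ∉ A × v ∉ B
    colouring≡0⇒∉ {v} eq with v ∈? A | v ∈? B
    colouring≡0⇒∉ () | yes _ | _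
    colouring≡0⇒∉ () | no _ | yes _
    colouring≡0⇒∉ refl | no v∉A | no v∉B = v∉A , v∉B

    colouring-is2RiDF : Independent A → Independent B → (∀ {v} → v ∈ B → v ∉ A) →
      (∀ {v} → v ∉ A → v ∉ B → HasNeighbourIn A v × HasNeighbourIn B v) → Is2RiDF K (colouring A B)
    colouring-is2RiDF A-independent B-independent B∩A≡∅ dominated = independent , rainbow
      where
        independent : ∀ i → toℕ i ≢ 0 → ∀ u v → colouring A B u ≡ i → colouring A B v ≡ i → ¬ Adj K u v
        independent 0F i≢0 _ _ _ _ = contradiction refl i≢0
        independent 1F _ _ _ u↦1 v↦1 = A-independent (colouring≡1⇒∈ u↦1) (colouring≡1⇒∈ v↦1)
        independent 2F _ _ _ u↦2 v↦2 = B-independent (colouring≡2⇒∈ u↦2) (colouring≡2⇒∈ v↦2)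
        rainbow : ∀ v → toℕ (colouring A B v) ≡ 0 → ∀ i → toℕ i ≢ 0 → ∃[ u ] (Adj K v u × colouring A B u ≡ i)
        rainbow v v↦0 i i≢0 with colouring≡0⇒∉ v↦0 | i
        ... | _ | 0F = contradiction refl i≢0
        ... | v∉A , v∉B | 1F = let u , u∈A , v~u = proj₁ (dominated v∉A v∉B) in
                                u , v~u , colouring-∈₁ u∈A
        ... | v∉A , v∉B | 2F = let u , u∈B , v~u = proj₂ (dominated v∉A v∉B) in
                                u , v~u , colouring-∈₂ (B∩A≡∅ u∈B) u∈B

  record DoublyDominatedPair : Set where
    field
      P Q           : Subset n
      P-independent : Independent P
      Q-independent : Independent Q
      P∩Q≡∅         : ∀ {v} → v ∈ P → v ∉ Q
      x y           : Fin n
      x≢y           : x ≢ y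
      x-P           : HasNeighbourIn P x
      x-Q           : HasNeighbourIn Q x
      y-P           : HasNeighbourIn P y
      y-Q           : HasNeighbourIn Q y

  doublyDominatedPair⇒2RiDF : DoublyDominatedPair → ∃[ f ] (Is2RiDF K f × weight f ≤ n ∸ 2)
  doublyDominatedPair⇒2RiDF W =
    colouring I₁ I₂ ,
    colouring-is2RiDF (independent E₁) (independent E₂) (proj₂ ∘ proj₂ ∘ within E₂) dominated ,
    weight≤n∸2 (colouring I₁ I₂) x≢y (colouring-∉ (x∉ E₁) (x∉ E₂)) (colouring-∉ (y∉ E₁) (y∉ E₂))
    where
      open DoublyDominatedPair W
      open IndependentExtension

      Avoiding : Subset n → Pred (Fin n) 0ℓ
      Avoiding S v = v ≢ x × v ≢ y × v ∉ S

      avoiding? : ∀ S → Decidable (Avoiding S)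
      avoiding? S v = ¬? (v ≟ x) ×-dec ¬? (v ≟ y) ×-dec ¬? (v ∈? S)

      ≢-of-dominated : ∀ {S u v} → Independent S → HasNeighbourIn S v → u ∈ S → u ≢ v
      ≢-of-dominated S-independent v-S u∈S refl = hasNeighbourIn⇒∉ S-independent v-S u∈S

      E₁ = extendIndependent (avoiding? Q) (allFin n) P-independent
             λ p∈P → ≢-of-dominated P-independent x-P p∈P , ≢-of-dominated P-independent y-P p∈P , P∩Q≡∅ p∈P
      I₁ = J E₁

      E₂ = extendIndependent (avoiding? I₁) (allFin n) Q-independent
             λ q∈Q → ≢-of-dominated Q-independent x-Q q∈Q , ≢-of-dominated Q-independent y-Q q∈Q ,
                     λ q∈I₁ → proj₂ (proj₂ (within E₁ q∈I₁)) q∈Q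
      I₂ = J E₂

      x∉ : ∀ {S T vs} (E : IndependentExtension (Avoiding S) T vs) → x ∉ J E
      x∉ E x∈ = proj₁ (within E x∈) refl
      y∉ : ∀ {S T vs} (E : IndependentExtension (Avoiding S) T vs) → y ∉ J E
      y∉ E y∈ = proj₁ (proj₂ (within E y∈)) refl

      dominated : ∀ {v} → v ∉ I₁ → v ∉ I₂ → HasNeighbourIn I₁ v × HasNeighbourIn I₂ v
      dominated {v} v∉I₁ v∉I₂ with v ≟ x | v ≟ y
      ... | yes refl | _ = hasNeighbourIn-mono (extends E₁) x-P , hasNeighbourIn-mono (extends E₂) x-Q
      ... | no _ | yes refl = hasNeighbourIn-mono (extends E₁) y-P , hasNeighbourIn-mono (extends E₂) y-Q
      ... | no v≢x | no v≢y =
        maximal E₁ (∈-allFin v) (v≢x , v≢y , λ v∈Q → v∉I₂ (extends E₂ v∈Q)) v∉I₁ ,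
        maximal E₂ (∈-allFin v) (v≢x , v≢y , v∉I₁) v∉I₂

-- A record rather than Adj, so that the endpoints can be inferred from an edge.
record Edge {n : ℕ} (K : Graph n) (u v : Fin n) : Set where
  constructor edge
  field adjacent : Adj K u v

open Edge

edge? : ∀ {n} (K : Graph n) u v → Dec (Edge K u v)
edge? K u v with adj K u v Bool.≟ true
... | yes u~v = yes (edge u~v)
... | no u≁v = no (u≁v ∘ adjacent)

CommonNeighbourCondition : ∀ {n} → Graph n → Set
CommonNeighbourCondition {n} K = ∀ {p a q : Fin n} → p ≡ a ⊎ Edge K p a → q ≢ p → q ≢ a →
  (∀ {v} → Edge K q v → v ≡ p ⊎ v ≡ a) → ∃[ z ] (z ≢ q × Edge K z p × Edge K z a)

record Cycle₅ {n : ℕ} (K : Graph n) : Set where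
  field
    c₀ c₁ c₂ c₃ c₄                : Fin n
    c₀~c₁ : Edge K c₀ c₁
    c₁~c₂ : Edge K c₁ c₂
    c₂~c₃ : Edge K c₂ c₃
    c₃~c₄ : Edge K c₃ c₄
    c₄~c₀ : Edge K c₄ c₀
    c₀≢c₂ : c₀ ≢ c₂
    c₀≢c₃ : c₀ ≢ c₃
    c₁≢c₃ : c₁ ≢ c₃
    c₁≢c₄ : c₁ ≢ c₄
    c₂≢c₄ : c₂ ≢ c₄

  OnCycle : Fin n → Set
  OnCycle w = w ≡ c₀ ⊎ w ≡ c₁ ⊎ w ≡ c₂ ⊎ w ≡ c₃ ⊎ w ≡ c₄

  OffCycle : Fin n → Set
  OffCycle w = w ≢ c₀ × w ≢ c₁ × w ≢ c₂ × w ≢ c₃ × w ≢ c₄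

  Chordless : Set
  Chordless = ¬ Edge K c₀ c₂ × ¬ Edge K c₀ c₃ × ¬ Edge K c₁ c₃ × ¬ Edge K c₁ c₄ × ¬ Edge K c₂ c₄

  Spanning : Set
  Spanning = ∀ w → OnCycle w

IsPentagon : ∀ {n} → Graph n → Set
IsPentagon K = ∃[ C ] (Cycle₅.Chordless {K = K} C × Cycle₅.Spanning C)

module _ {n : ℕ} {K : Graph n} where

  private
    infix 4 _~_
    _~_ : Fin n → Fin n → Set
    _~_ = Edge K

    _~?_ : ∀ u v → Dec (u ~ v)
    _~?_ = edge? K

  ~-irrefl : ∀ {u v} → u ~ v → u ≢ v
  ~-irrefl {u} u~v refl = Adj-irrefl K u (adjacent u~v)

  ~-sym : ∀ {u v} → u ~ v → v ~ u
  ~-sym u~v = edge (Adj-sym K (adjacent u~v))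

  ≁-sym : ∀ {u v} → ¬ u ~ v → ¬ v ~ u
  ≁-sym u≁v = u≁v ∘ ~-sym

  pair-independent : ∀ {p q} → ¬ p ~ q → Independent K (pair p q)
  pair-independent p≁q u∈ v∈ with ∈-pair⁻ u∈ | ∈-pair⁻ v∈
  ... | inj₁ refl | inj₁ refl = Adj-irrefl K _
  ... | inj₁ refl | inj₂ refl = p≁q ∘ edge
  ... | inj₂ refl | inj₁ refl = p≁q ∘ ~-sym ∘ edge
  ... | inj₂ refl | inj₂ refl = Adj-irrefl K _

  pair-neighbour : ∀ {x p q} → x ~ p ⊎ x ~ q → HasNeighbourIn K (pair p q) x
  pair-neighbour (inj₁ x~p) = _ , ∈-pair⁺ (inj₁ refl) , adjacent x~p
  pair-neighbour (inj₂ x~q) = _ , ∈-pair⁺ (inj₂ refl) , adjacent x~q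

  ≁-self : ∀ {v} → ¬ v ~ v
  ≁-self v~v = ~-irrefl v~v refl

  pairs : ∀ {p₁ p₂ q₁ q₂ x y} → ¬ p₁ ~ p₂ → ¬ q₁ ~ q₂ →
    p₁ ≢ q₁ → p₁ ≢ q₂ → p₂ ≢ q₁ → p₂ ≢ q₂ → x ≢ y →
    x ~ p₁ ⊎ x ~ p₂ → x ~ q₁ ⊎ x ~ q₂ → y ~ p₁ ⊎ y ~ p₂ → y ~ q₁ ⊎ y ~ q₂ → DoublyDominatedPair K
  pairs {p₁} {p₂} {q₁} {q₂} p₁≁p₂ q₁≁q₂ p₁≢q₁ p₁≢q₂ p₂≢q₁ p₂≢q₂ x≢y x-P x-Q y-P y-Q = record
    { P = pair p₁ p₂ ; Q = pair q₁ q₂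
    ; P-independent = pair-independent p₁≁p₂ ; Q-independent = pair-independent q₁≁q₂
    ; P∩Q≡∅ = P∩Q≡∅ ; x≢y = x≢y
    ; x-P = pair-neighbour x-P ; x-Q = pair-neighbour x-Q ; y-P = pair-neighbour y-P ; y-Q = pair-neighbour y-Q }
    where
      P∩Q≡∅ : ∀ {v} → v ∈ pair p₁ p₂ → v ∉ pair q₁ q₂
      P∩Q≡∅ v∈P v∈Q with ∈-pair⁻ v∈P | ∈-pair⁻ v∈Q
      ... | inj₁ refl | inj₁ refl = p₁≢q₁ refl
      ... | inj₁ refl | inj₂ refl = p₁≢q₂ refl
      ... | inj₂ refl | inj₁ refl = p₂≢q₁ refl
      ... | inj₂ refl | inj₂ refl = p₂≢q₂ refl

  square : ∀ {p q x y} → p ≢ q → x ≢ y → x ~ p → x ~ q → y ~ p → y ~ q → DoublyDominatedPair K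
  square p≢q x≢y x~p x~q y~p y~q =
    pairs ≁-self ≁-self p≢q p≢q p≢q p≢q x≢y (inj₁ x~p) (inj₁ x~q) (inj₁ y~p) (inj₁ y~q)

  neighbourOutside : ∀ v p z → (∃[ m ] (v ~ m × m ≢ p × m ≢ z)) ⊎ (∀ {m} → v ~ m → m ≡ p ⊎ m ≡ z)
  neighbourOutside v p z with any? (λ m → v ~? m ×-dec ¬? (m ≟ p) ×-dec ¬? (m ≟ z))
  ... | yes found = inj₁ found
  ... | no none = inj₂ λ {m} v~m → decide (m ≟ p) (m ≟ z) v~m
    where
      decide : ∀ {m} → Dec (m ≡ p) → Dec (m ≡ z) → v ~ m → m ≡ p ⊎ m ≡ z
      decide (yes m≡p) _ _ = inj₁ m≡p
      decide (no _) (yes m≡z) _ = inj₂ m≡z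
      decide (no m≢p) (no m≢z) v~m = contradiction (_ , v~m , m≢p , m≢z) none

  module _ (common : CommonNeighbourCondition K) where

    triangle : ∀ {p a z} → p ~ a → a ~ z → p ~ z → DoublyDominatedPair K
    triangle {p} {a} {z} p~a a~z p~z with neighbourOutside a p z | neighbourOutside z p a
    ... | inj₂ N[a]⊆pz | _ =
      let w , w≢a , w~p , w~z = common (inj₂ p~z) (≢-sym (~-irrefl p~a)) (~-irrefl a~z) N[a]⊆pz
      in square (~-irrefl p~z) (≢-sym w≢a) (~-sym p~a) a~z w~p w~z
    ... | inj₁ _ | inj₂ N[z]⊆pa =
      let w , w≢z , w~p , w~a = common (inj₂ p~a) (≢-sym (~-irrefl p~z)) (≢-sym (~-irrefl a~z)) N[z]⊆pa
      in square (~-irrefl p~a) (≢-sym w≢z) (~-sym p~z) (~-sym a~z) w~p w~a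
    ... | inj₁ (m , a~m , m≢p , m≢z) | inj₁ (m′ , z~m′ , m′≢p , m′≢a) with m ≟ m′ | m ~? m′
    ...   | yes refl | _ = square (~-irrefl a~z) (≢-sym m≢p) p~a p~z (~-sym a~m) (~-sym z~m′)
    ...   | no _ | yes m~m′ = square (≢-sym m≢z) (≢-sym m′≢a) a~z a~m (~-sym z~m′) (~-sym m~m′)
    ...   | no _ | no m≁m′ =
      pairs ≁-self m≁m′ (≢-sym m≢p) (≢-sym m′≢p) (≢-sym m≢p) (≢-sym m′≢p) (~-irrefl a~z)
        (inj₁ (~-sym p~a)) (inj₁ a~m) (inj₁ (~-sym p~z)) (inj₂ z~m′)

    withNeighbour : ∀ {v w} → w ≢ v → (∀ {u} → v ~ u → DoublyDominatedPair K) → DoublyDominatedPair K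
    withNeighbour {v} {w} w≢v k with any? (v ~?_)
    ... | yes (u , v~u) = k v~u
    ... | no isolated =
      let a , a≢v , a~w , _ = common (inj₁ refl) (≢-sym w≢v) (≢-sym w≢v) no-neighbour
          b , b≢v , b~w , b~a = common (inj₂ (~-sym a~w)) (≢-sym w≢v) (≢-sym a≢v) no-neighbour
      in triangle (~-sym a~w) (~-sym b~a) (~-sym b~w)
      where
        no-neighbour : ∀ {u a} → v ~ u → u ≡ w ⊎ u ≡ a
        no-neighbour v~u = contradiction (_ , v~u) isolated

    withSecondNeighbour : ∀ {v p} → v ~ p → (∀ {y} → v ~ y → y ≢ p → DoublyDominatedPair K) →
                          DoublyDominatedPair K
    withSecondNeighbour {v} {p} v~p k with any? (λ y → v ~? y ×-dec ¬? (y ≟ p))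
    ... | yes (y , v~y , y≢p) = k v~y y≢p
    ... | no none =
      let z , z≢v , z~p , _ = common (inj₁ refl) v≢p v≢p (inj₁ ∘ onlyP)
          w , _ , w~p , w~z = common (inj₂ (~-sym z~p)) v≢p (≢-sym z≢v) (inj₁ ∘ onlyP)
      in triangle (~-sym z~p) (~-sym w~z) (~-sym w~p)
      where
        v≢p = ~-irrefl v~p
        onlyP : ∀ {u} → v ~ u → u ≡ p
        onlyP {u} v~u = decidable-stable (u ≟ p) λ u≢p → none (u , v~u , u≢p)

    rotate : Cycle₅ K → Cycle₅ K
    rotate C = record
      { c₀ = c₁ ; c₁ = c₂ ; c₂ = c₃ ; c₃ = c₄ ; c₄ = c₀
      ; c₀~c₁ = c₁~c₂ ; c₁~c₂ = c₂~c₃ ; c₂~c₃ = c₃~c₄ ; c₃~c₄ = c₄~c₀ ; c₄~c₀ = c₀~c₁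
      ; c₀≢c₂ = c₁≢c₃ ; c₀≢c₃ = c₁≢c₄ ; c₁≢c₃ = c₂≢c₄ ; c₁≢c₄ = ≢-sym c₀≢c₂ ; c₂≢c₄ = ≢-sym c₀≢c₃ }
      where open Cycle₅ C

    rotate-offCycle : ∀ C {w} → Cycle₅.OffCycle C w → Cycle₅.OffCycle (rotate C) w
    rotate-offCycle C (w≢c₀ , w≢c₁ , w≢c₂ , w≢c₃ , w≢c₄) = w≢c₁ , w≢c₂ , w≢c₃ , w≢c₄ , w≢c₀

    module _ (C : Cycle₅ K) where
      open Cycle₅ C

      attachedToCycle : ∀ {w} → OffCycle w → w ~ c₀ → DoublyDominatedPair K
      attachedToCycle {w} (w≢c₀ , w≢c₁ , w≢c₂ , _ , w≢c₄) w~c₀ with w ~? c₃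
      ... | yes w~c₃ = square c₀≢c₃ w≢c₄ w~c₀ w~c₃ c₄~c₀ (~-sym c₃~c₄)
      ... | no w≁c₃ =
        pairs ≁-self w≁c₃ (≢-sym w≢c₁) c₁≢c₃ (≢-sym w≢c₁) c₁≢c₃ c₀≢c₂
          (inj₁ c₀~c₁) (inj₁ (~-sym w~c₀)) (inj₁ (~-sym c₁~c₂)) (inj₂ c₂~c₃)

    unlessAdjacentToCycle : ∀ C {w} → Cycle₅.OffCycle C w →
      (let open Cycle₅ C in ¬ w ~ c₀ → ¬ w ~ c₁ → ¬ w ~ c₂ → ¬ w ~ c₃ → ¬ w ~ c₄ → DoublyDominatedPair K) →
      DoublyDominatedPair K
    unlessAdjacentToCycle C {w} off k = decide (w ~? c₀) (w ~? c₁) (w ~? c₂) (w ~? c₃) (w ~? c₄)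
      where
        open Cycle₅ C
        C¹ = rotate C
        C² = rotate C¹
        C³ = rotate C²
        C⁴ = rotate C³
        off¹ = rotate-offCycle C off
        off² = rotate-offCycle C¹ off¹
        off³ = rotate-offCycle C² off²
        off⁴ = rotate-offCycle C³ off³
        decide : Dec (w ~ c₀) → Dec (w ~ c₁) → Dec (w ~ c₂) → Dec (w ~ c₃) → Dec (w ~ c₄) →
                 DoublyDominatedPair K
        decide (yes w~c₀) _ _ _ _ = attachedToCycle C off w~c₀
        decide (no _) (yes w~c₁) _ _ _ = attachedToCycle C¹ off¹ w~c₁
        decide (no _) (no _) (yes w~c₂) _ _ = attachedToCycle C² off² w~c₂
        decide (no _) (no _) (no _) (yes w~c₃) _ = attachedToCycle C³ off³ w~c₃
        decide (no _) (no _) (no _) (no _) (yes w~c₄) = attachedToCycle C⁴ off⁴ w~c₄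
        decide (no w≁c₀) (no w≁c₁) (no w≁c₂) (no w≁c₃) (no w≁c₄) = k w≁c₀ w≁c₁ w≁c₂ w≁c₃ w≁c₄

    offCycleVertex : ∀ C {w} → Cycle₅.OffCycle C w → DoublyDominatedPair K
    offCycleVertex C {w} off@(w≢c₀ , w≢c₁ , _ , _ , w≢c₄) =
      unlessAdjacentToCycle C off λ w≁c₀ w≁c₁ w≁c₂ w≁c₃ w≁c₄ →
      withNeighbour (≢-sym w≢c₀) λ w~u₁ → withSecondNeighbour w~u₁ λ w~u₂ u₂≢u₁ →
      let off₁@(_ , u₁≢c₁ , _ , _ , u₁≢c₄) = far w~u₁ w≁c₀ w≁c₁ w≁c₂ w≁c₃ w≁c₄
          off₂@(_ , u₂≢c₁ , _ , _ , u₂≢c₄) = far w~u₂ w≁c₀ w≁c₁ w≁c₂ w≁c₃ w≁c₄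
      in
      unlessAdjacentToCycle C off₁ λ _ u₁≁c₁ _ _ _ →
      unlessAdjacentToCycle C off₂ λ _ _ _ _ u₂≁c₄ →
      pairs (≁-sym u₁≁c₁) (≁-sym u₂≁c₄) c₁≢c₄ (≢-sym u₂≢c₁) u₁≢c₄ (≢-sym u₂≢u₁) (≢-sym w≢c₀)
        (inj₁ c₀~c₁) (inj₁ (~-sym c₄~c₀)) (inj₂ w~u₁) (inj₂ w~u₂)
      where
        open Cycle₅ C
        far : ∀ {u} → w ~ u → ¬ w ~ c₀ → ¬ w ~ c₁ → ¬ w ~ c₂ → ¬ w ~ c₃ → ¬ w ~ c₄ → OffCycle u
        far w~u w≁c₀ w≁c₁ w≁c₂ w≁c₃ w≁c₄ =
          (λ { refl → w≁c₀ w~u }) , (λ { refl → w≁c₁ w~u }) , (λ { refl → w≁c₂ w~u }) ,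
          (λ { refl → w≁c₃ w~u }) , (λ { refl → w≁c₄ w~u })

    module _ (not-pentagon : ¬ IsPentagon K) where

      cycle₅ : Cycle₅ K → DoublyDominatedPair K
      cycle₅ C = decide (c₀ ~? c₂) (c₀ ~? c₃) (c₁ ~? c₃) (c₁ ~? c₄) (c₂ ~? c₄)
        where
          open Cycle₅ C
          onCycle? : ∀ w → Dec (OnCycle w)
          onCycle? w = w ≟ c₀ ⊎-dec w ≟ c₁ ⊎-dec w ≟ c₂ ⊎-dec w ≟ c₃ ⊎-dec w ≟ c₄
          offCycle : ∀ {w} → ¬ OnCycle w → OffCycle w
          offCycle ¬on = ¬on ∘ inj₁ , ¬on ∘ inj₂ ∘ inj₁ , ¬on ∘ inj₂ ∘ inj₂ ∘ inj₁ ,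
                         ¬on ∘ inj₂ ∘ inj₂ ∘ inj₂ ∘ inj₁ , ¬on ∘ inj₂ ∘ inj₂ ∘ inj₂ ∘ inj₂
          decide : Dec (c₀ ~ c₂) → Dec (c₀ ~ c₃) → Dec (c₁ ~ c₃) → Dec (c₁ ~ c₄) → Dec (c₂ ~ c₄) →
                   DoublyDominatedPair K
          decide (yes c₀~c₂) _ _ _ _ = triangle c₀~c₁ c₁~c₂ c₀~c₂
          decide _ (yes c₀~c₃) _ _ _ = triangle c₃~c₄ c₄~c₀ (~-sym c₀~c₃)
          decide _ _ (yes c₁~c₃) _ _ = triangle c₁~c₂ c₂~c₃ c₁~c₃
          decide _ _ _ (yes c₁~c₄) _ = triangle c₄~c₀ c₀~c₁ (~-sym c₁~c₄)
          decide _ _ _ _ (yes c₂~c₄) = triangle c₂~c₃ c₃~c₄ c₂~c₄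
          decide (no c₀≁c₂) (no c₀≁c₃) (no c₁≁c₃) (no c₁≁c₄) (no c₂≁c₄) with any? (¬? ∘ onCycle?)
          ... | yes (w , w-off) = offCycleVertex C (offCycle w-off)
          ... | no none-off = contradiction
                  (C , (c₀≁c₂ , c₀≁c₃ , c₁≁c₃ , c₁≁c₄ , c₂≁c₄) ,
                   λ w → decidable-stable (onCycle? w) (none-off ∘ (w ,_)))
                  not-pentagon

      path₄ : ∀ {p x y x′ y′} → p ~ x → p ~ y → y ≢ x → x ~ x′ → x′ ≢ p → y ~ y′ → y′ ≢ p →
              DoublyDominatedPair K
      path₄ {p} {x} {y} {x′} {y′} p~x p~y y≢x x~x′ x′≢p y~y′ y′≢p
        with x ~? y | x′ ≟ y′ | x ≟ y′ | y ≟ x′ | x′ ~? y′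
      ... | yes x~y | _ | _ | _ | _ = triangle p~x x~y p~y
      ... | no _ | yes refl | _ | _ | _ = square (≢-sym x′≢p) (≢-sym y≢x) (~-sym p~x) x~x′ (~-sym p~y) y~y′
      ... | no _ | no _ | yes refl | _ | _ = triangle p~x (~-sym y~y′) p~y
      ... | no _ | no _ | no _ | yes refl | _ = triangle p~x x~x′ p~y
      ... | no _ | no _ | no x≢y′ | no y≢x′ | no x′≁y′ =
        pairs ≁-self x′≁y′ (≢-sym x′≢p) (≢-sym y′≢p) (≢-sym x′≢p) (≢-sym y′≢p) (≢-sym y≢x)
          (inj₁ (~-sym p~x)) (inj₁ x~x′) (inj₁ (~-sym p~y)) (inj₂ y~y′)
      ... | no _ | no _ | no x≢y′ | no y≢x′ | yes x′~y′ = cycle₅ record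
        { c₀ = p ; c₁ = x ; c₂ = x′ ; c₃ = y′ ; c₄ = y
        ; c₀~c₁ = p~x ; c₁~c₂ = x~x′ ; c₂~c₃ = x′~y′ ; c₃~c₄ = ~-sym y~y′ ; c₄~c₀ = ~-sym p~y
        ; c₀≢c₂ = ≢-sym x′≢p ; c₀≢c₃ = ≢-sym y′≢p ; c₁≢c₃ = x≢y′ ; c₁≢c₄ = ≢-sym y≢x ; c₂≢c₄ = ≢-sym y≢x′ }

      doublyDominatedPair : ∀ {v₀ v₁} → v₁ ≢ v₀ → DoublyDominatedPair K
      doublyDominatedPair v₁≢v₀ =
        withNeighbour v₁≢v₀ λ p~x → withSecondNeighbour p~x λ p~y y≢x →
        withSecondNeighbour (~-sym p~x) λ x~x′ x′≢p → withSecondNeighbour (~-sym p~y) λ y~y′ y′≢p →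
        path₄ p~x p~y y≢x x~x′ x′≢p y~y′ y′≢p

C5adj-injective : ∀ i j → (∀ k → C5adj i k ≡ C5adj j k) → i ≡ j
C5adj-injective = toWitness {a? = all? λ i → all? λ j → all? (λ k → C5adj i k Bool.≟ C5adj j k) →-dec i ≟ j} _

module _ {n : ℕ} (G : Graph n) where

  private
    H = complement G

    _~?_ : ∀ u v → Dec (Edge H u v)
    _~?_ = edge? H

  complement-adj : ∀ {u v} → u ≢ v → adj H u v ≡ not (adj G u v)
  complement-adj {u} {v} u≢v with u ≟ v
  ... | yes u≡v = contradiction u≡v u≢v
  ... | no _ = refl

  complement-edge : ∀ {u v} → Edge H u v → adj G u v ≡ false
  complement-edge (edge u~v) = not-injective (trans (sym (complement-adj (~-irrefl {K = H} (edge u~v)))) u~v)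

  complement-edge⇒¬Adj : ∀ {u v} → Edge H u v → ¬ Adj G u v
  complement-edge⇒¬Adj u~v u~v-in-G with () ← trans (sym u~v-in-G) (complement-edge u~v)

  complement-nonedge : ∀ {u v} → u ≢ v → ¬ Edge H u v → Adj G u v
  complement-nonedge {u} {v} u≢v u≁v with adj G u v in eq
  ... | true = refl
  ... | false = contradiction (edge (trans (complement-adj u≢v) (cong not eq))) u≁v

  complement-pentagon⇒IsoToC5 : IsPentagon (complement G) → IsoToC5 G
  complement-pentagon⇒IsoToC5 (C , (c₀≁c₂ , c₀≁c₃ , c₁≁c₃ , c₁≁c₄ , c₂≁c₄) , spanning) =
    mk↔ₛ′ to from to∘from from∘to ,
    λ u v → trans (cong₂ (adj G) (sym (from∘to u)) (sym (from∘to v))) (adj-from (to u) (to v))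
    where
      open Cycle₅ C

      -- G is the 5-cycle c₀ c₂ c₄ c₁ c₃ formed by the chords of C.
      from : Fin 5 → Fin n
      from 0F = c₀
      from 1F = c₂
      from 2F = c₄
      from 3F = c₁
      from 4F = c₃

      index : ∀ {w} → OnCycle w → Fin 5
      index (inj₁ _)                      = 0F
      index (inj₂ (inj₁ _))               = 3F
      index (inj₂ (inj₂ (inj₁ _)))        = 1F
      index (inj₂ (inj₂ (inj₂ (inj₁ _)))) = 4F
      index (inj₂ (inj₂ (inj₂ (inj₂ _)))) = 2F

      to : Fin n → Fin 5
      to w = index (spanning w)

      from-index : ∀ {w} (w-on : OnCycle w) → from (index w-on) ≡ w
      from-index (inj₁ refl)                      = refl
      from-index (inj₂ (inj₁ refl))               = refl
      from-index (inj₂ (inj₂ (inj₁ refl)))        = refl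
      from-index (inj₂ (inj₂ (inj₂ (inj₁ refl)))) = refl
      from-index (inj₂ (inj₂ (inj₂ (inj₂ refl)))) = refl

      from∘to : ∀ w → from (to w) ≡ w
      from∘to w = from-index (spanning w)

      side : ∀ {u v} → Edge (complement G) u v → adj G u v ≡ false
      side = complement-edge

      chord : ∀ {u v} → u ≢ v → ¬ Edge (complement G) u v → adj G u v ≡ true
      chord = complement-nonedge

      adj-from : ∀ i j → adj G (from i) (from j) ≡ C5adj i j
      adj-from 0F 0F = adj-irref G c₀
      adj-from 0F 1F = chord c₀≢c₂ c₀≁c₂
      adj-from 0F 2F = side (~-sym c₄~c₀)
      adj-from 0F 3F = side c₀~c₁
      adj-from 0F 4F = chord c₀≢c₃ c₀≁c₃
      adj-from 1F 0F = chord (≢-sym c₀≢c₂) (≁-sym c₀≁c₂)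
      adj-from 1F 1F = adj-irref G c₂
      adj-from 1F 2F = chord c₂≢c₄ c₂≁c₄
      adj-from 1F 3F = side (~-sym c₁~c₂)
      adj-from 1F 4F = side c₂~c₃
      adj-from 2F 0F = side c₄~c₀
      adj-from 2F 1F = chord (≢-sym c₂≢c₄) (≁-sym c₂≁c₄)
      adj-from 2F 2F = adj-irref G c₄
      adj-from 2F 3F = chord (≢-sym c₁≢c₄) (≁-sym c₁≁c₄)
      adj-from 2F 4F = side (~-sym c₃~c₄)
      adj-from 3F 0F = side (~-sym c₀~c₁)
      adj-from 3F 1F = side c₁~c₂
      adj-from 3F 2F = chord c₁≢c₄ c₁≁c₄
      adj-from 3F 3F = adj-irref G c₁
      adj-from 3F 4F = chord c₁≢c₃ c₁≁c₃
      adj-from 4F 0F = chord (≢-sym c₀≢c₃) (≁-sym c₀≁c₃)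
      adj-from 4F 1F = side (~-sym c₂~c₃)
      adj-from 4F 2F = side c₃~c₄
      adj-from 4F 3F = chord (≢-sym c₁≢c₃) (≁-sym c₁≁c₃)
      adj-from 4F 4F = adj-irref G c₃

      from-injective : ∀ {i j} → from i ≡ from j → i ≡ j
      from-injective {i} {j} from-i≡from-j = C5adj-injective i j λ k → begin
        C5adj i k              ≡⟨ adj-from i k ⟨
        adj G (from i) (from k) ≡⟨ cong (λ w → adj G w (from k)) from-i≡from-j ⟩
        adj G (from j) (from k) ≡⟨ adj-from j k ⟩
        C5adj j k              ∎
        where open ≡-Reasoning

      to∘from : ∀ i → to (from i) ≡ i
      to∘from i = from-injective (from∘to (from i))

  module _ (γ≥4 : ∀ f → Is2RiDF G f → 4 ≤ weight f) where

    -- Otherwise p, a ↦ 1 and q ↦ 2 would be a 2RiDF of G of weight at most 3.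
    complement-commonNeighbour : CommonNeighbourCondition H
    complement-commonNeighbour {p} {a} {q} p≡a⊎p~a q≢p q≢a N[q]⊆pa
      with any? (λ z → ¬? (z ≟ q) ×-dec z ~? p ×-dec z ~? a)
    ... | yes found = found
    ... | no none = contradiction (γ≥4 f f-2RiDF) (<⇒≱ (s≤s wf≤3))
      where
        A = pair p a
        f = colouring G A ⁅ q ⁆

        p≁a : ¬ Adj G p a
        p≁a = [ (λ { refl → Adj-irrefl G p }) , complement-edge⇒¬Adj ]′ p≡a⊎p~a

        q∉A : ∀ {v} → v ∈ ⁅ q ⁆ → v ∉ A
        q∉A v∈q v∈A rewrite x∈⁅y⁆⇒x≡y q v∈q = [ q≢p , q≢a ]′ (∈-pair⁻ v∈A)

        dominated : ∀ {v} → v ∉ A → v ∉ ⁅ q ⁆ → HasNeighbourIn G A v × HasNeighbourIn G ⁅ q ⁆ v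
        dominated {v} v∉A v∉q = A-dominates (v ~? p) (v ~? a) , q-dominates (v ~? q)
          where
            v≢p = v∉A ∘ ∈-pair⁺ ∘ inj₁
            v≢a = v∉A ∘ ∈-pair⁺ ∘ inj₂
            v≢q : v ≢ q
            v≢q refl = v∉q (x∈⁅x⁆ q)

            A-dominates : Dec (Edge H v p) → Dec (Edge H v a) → HasNeighbourIn G A v
            A-dominates (no v≁p) _ = p , ∈-pair⁺ (inj₁ refl) , complement-nonedge v≢p v≁p
            A-dominates (yes _) (no v≁a) = a , ∈-pair⁺ (inj₂ refl) , complement-nonedge v≢a v≁a
            A-dominates (yes v~p) (yes v~a) = contradiction (v , v≢q , v~p , v~a) none

            q-dominates : Dec (Edge H v q) → HasNeighbourIn G ⁅ q ⁆ v
            q-dominates (no v≁q) = q , x∈⁅x⁆ q , complement-nonedge v≢q v≁q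
            q-dominates (yes v~q) = contradiction (N[q]⊆pa (~-sym v~q)) [ v≢p , v≢a ]′

        f-2RiDF : Is2RiDF G f
        f-2RiDF = colouring-is2RiDF G (pair-independent {K = G} (p≁a ∘ adjacent)) (singleton-independent G q) q∉A dominated

        wf≤3 : weight f ≤ 3
        wf≤3 = weight≤length f supported
          where
            supported : ∀ {v} → toℕ (f v) ≢ 0 → v ∈ₗ p ∷ a ∷ q ∷ []
            supported {v} fv≢0 = decide (v ∈? A) (v ∈? ⁅ q ⁆)
              where
                decide : Dec (v ∈ A) → Dec (v ∈ ⁅ q ⁆) → v ∈ₗ p ∷ a ∷ q ∷ []
                decide (yes v∈A) _ = [ (λ { refl → here refl }) , (λ { refl → there (here refl) }) ]′ (∈-pair⁻ v∈A)
                decide (no _) (yes v∈q) = there (there (here (x∈⁅y⁆⇒x≡y q v∈q)))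
                decide (no v∉A) (no v∉q) = contradiction (colouring-∉ G v∉A v∉q) fv≢0

lemma6 : ∀ (n : ℕ) (G : Graph n) → ¬ IsoToC5 G → IsGammaRi2 G 4 →
    ∀ (m : ℕ) → IsGammaRi2 (complement G) m → m ≤ n ∸ 2
lemma6 0 G _ ((f , _ , wf≡4) , _) _ _ = contradiction (subst (_≤ 0) wf≡4 (weight≤n f)) λ ()
lemma6 1 G _ ((f , _ , wf≡4) , _) _ _ = contradiction (subst (_≤ 1) wf≡4 (weight≤n f)) λ { (s≤s ()) }
lemma6 (suc (suc k)) G G≄C5 (_ , γ≥4) m (_ , minimal) =
  let f , f-2RiDF , wf≤n∸2 = doublyDominatedPair⇒2RiDF (complement G) dominated-pair
  in ≤-trans (minimal f f-2RiDF) wf≤n∸2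
  where
    dominated-pair : DoublyDominatedPair (complement G)
    dominated-pair = doublyDominatedPair {K = complement G} (complement-commonNeighbour G γ≥4)
                       (G≄C5 ∘ complement-pentagon⇒IsoToC5 G) {v₀ = 0F} {v₁ = 1F} λ ()
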